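{- Let $r_0=\max(2,D,2\|\mathcal{A}\|+1)$, let $r$ be an integer with $r'=r-r_0\ge0$. Then for every automorphism $\phi$ of $B_r$, the restriction of $\phi$ to $B'_{r'}$ is an automorphism of $B'_{r'}$.
   Context: Let $G$ be a free abelian group of finite rank $k\ge1$, identified with $\mathbb{Z}^k$, and $\mathcal{A}\subset G$ a finite generating set with $\mathcal{A}=-\mathcal{A}$, $0\notin\mathcal{A}$. $\Gamma=\mathrm{Cay}(G,\mathcal{A})$ has vertex set $G$ and edges $\{x,x+a\}$, $a\in\mathcal{A}$. $\rho(x)$ is the length of a shortest path in $\Gamma$ from $0$ to $x$, $\omega(x)$ the number of such shortest paths. $B_r$ is the subgraph of $\Gamma$ induced by $\{x:\rho(x)\le r\}$. An element $x\in\mathcal{A}$ is primary if $\rho(tx)=t$ and $\omega(tx)=1$ for all integers $t\ge0$, otherwise secondary; $\overline{\mathcal{A}'}$ denotes the set of secondary elements. $D$ is a fixed positive integer such that every secondary $x$ satisfies $\rho(Dx)\ne D$ or $\omega(Dx)\ne1$. $\|x\|$ is the $\ell_\infty$-norm on $\mathbb{Z}^k$, $\|\mathcal{A}\|=\max_{x\in\mathcal{A}}\|x\|$. $\Gamma'$ is the Cayley graph of the additive group generated by $\overline{\mathcal{A}'}$ with generating set $\overline{\mathcal{A}'}$, and $B'_{r'}$ is the subgraph of $\Gamma'$ induced by the vertices at distance at most $r'$ from $0$ in $\Gamma'$ (a subgraph of $B_{r'}$). -}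

module Defs where

open import Data.Nat as ℕ using (ℕ; _≤_; _⊔_)
open import Data.Integer as ℤ using (ℤ; +_; ∣_∣)
open import Data.Vec using (Vec; zipWith; replicate; map; foldr)
open import Data.List as List using (List; length)
open import Data.List.Relation.Unary.All using (All)
open import Data.List.Membership.Propositional using (_∈_)
open import Data.Product using (Σ; _×_; ∃)
open import Relation.Binary.PropositionalEquality using (_≡_)
open import Relation.Nullary using (¬_)

V : ℕ → Set
V k = Vec ℤ k

module _ {k : ℕ} where

  zeroV : V k
  zeroV = replicate k (+ 0)

  _⊕_ : V k → V k → V k
  _⊕_ = zipWith ℤ._+_

  ⊖_ : V k → V k
  ⊖_ = map (λ z → ℤ.- z)

  _⊝_ : V k → V k → V k
  x ⊝ y = x ⊕ (⊖ y)

  _·_ : ℕ → V k → V k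
  t · x = map (λ z → (+ t) ℤ.* z) x

  ∥_∥ : V k → ℕ
  ∥ x ∥ = foldr (λ _ → ℕ) (λ z m → ∣ z ∣ ⊔ m) 0 x

  wsum : List (V k) → V k
  wsum = List.foldr _⊕_ zeroV

  -- Words over a set of generators given by a predicate P.
  -- A word w with wsum w ≡ x of length n corresponds exactly to a path
  -- of length n from 0 to x in the Cayley graph (vertices 0, w₁, w₁+w₂, …).
  module Words (P : V k → Set) where

    Word : List (V k) → Set
    Word = All P

    DistLe : ℕ → V k → Set
    DistLe n x = Σ (List (V k)) λ w → Word w × length w ≤ n × wsum w ≡ x

    DistEq : V k → ℕ → Set
    DistEq x n = (Σ (List (V k)) λ w → Word w × length w ≡ n × wsum w ≡ x)
               × (∀ w → Word w → wsum w ≡ x → n ≤ length w)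

    AtMostOneGeodesic : V k → ℕ → Set
    AtMostOneGeodesic x n = ∀ w₁ w₂ → Word w₁ → Word w₂ →
      length w₁ ≡ n → length w₂ ≡ n → wsum w₁ ≡ x → wsum w₂ ≡ x → w₁ ≡ w₂

    DistEqUnique : V k → ℕ → Set
    DistEqUnique x n = DistEq x n × AtMostOneGeodesic x n

    Adj : V k → V k → Set
    Adj x y = P (y ⊝ x)

  -- automorphism of the graph with vertex predicate Vt and edge relation E,
  -- given by the restriction of f : V k → V k to the vertex set
  record IsGraphAut (Vt : V k → Set) (E : V k → V k → Set) (f : V k → V k) : Set where
    field
      maps-to   : ∀ x → Vt x → Vt (f x)
      injective : ∀ x y → Vt x → Vt y → f x ≡ f y → x ≡ y
      surjective : ∀ y → Vt y → Σ (V k) λ x → Vt x × f x ≡ y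
      adj→      : ∀ x y → Vt x → Vt y → E x y → E (f x) (f y)
      adj←      : ∀ x y → Vt x → Vt y → E (f x) (f y) → E x y

  module Cayley (𝒜 : List (V k)) where

    InA : V k → Set
    InA a = a ∈ 𝒜

    open Words InA public

    Primary : V k → Set
    Primary x = ∀ (t : ℕ) → DistEqUnique (t · x) t

    Secondary : V k → Set
    Secondary x = x ∈ 𝒜 × ¬ Primary x

    normA : ℕ
    normA = List.foldr (λ a m → ∥ a ∥ ⊔ m) 0 𝒜

    -- B_r : induced subgraph on {x : ρ(x) ≤ r}
    IsAutB : ℕ → (V k → V k) → Set
    IsAutB r f = IsGraphAut (DistLe r) Adj f

    -- B'_{r'} : ball of radius r' in Γ' = Cay(⟨𝒜'⟩, 𝒜')
    module W' = Words Secondary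

    IsAutB' : ℕ → (V k → V k) → Set
    IsAutB' r' f = IsGraphAut (W'.DistLe r') W'.Adj f

    record Hyp : Set where
      field
        symm      : ∀ a → a ∈ 𝒜 → (⊖ a) ∈ 𝒜
        no-zero   : ¬ (zeroV ∈ 𝒜)
        generates : ∀ x → Σ (List (V k)) λ w → Word w × wsum w ≡ x

-- We encode an automorphism φ of B_r by its graph R x y := (x ∈ B_r ∧ φ x = y)
-- and work with relations that, like R and its converse, are total on B_r,
-- functional and edge-preserving ("ball maps").  The development is:
--   * walks starting in a small ball lift along a ball map, step by step
--     (Track, lift-walk);
--   * the centre 0 is the only vertex from which all of B_r is reachable by
--     words of length ≤ r (covers⇒zero, via extremal coordinate functionals),
--     so a ball isomorphism fixes 0 and hence preserves every radius s ≤ r;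
--   * unique geodesics transfer along lifted walks (track-geodesic), so
--     "D·a has a unique geodesic of length D" passes from a to the image b of
--     an edge labelled a (power-transfer); with the defining property of D this
--     shows that secondary edges go to secondary edges (secondary-step);
--   * hence secondary walks of length ≤ r' = r − r₀ lift to secondary walks,
--     which gives all the properties of an automorphism of B'_{r'}.

module Submission where

open import Defs
open import Data.Nat using (ℕ; _≤_; _⊔_; _*_; _+_; _∸_)
open import Data.List using (List)
open import Relation.Nullary using (¬_)

open import Level using (0ℓ)
open import Algebra.Bundles using (AbelianGroup)
import Algebra.Properties.AbelianGroup as AbelianGroupProperties
open import Data.Nat using (zero; suc; z≤n; s≤s; _≤′_; ≤′-refl; ≤′-step)
import Data.Nat.Properties as ℕP
open import Data.Integer as ℤ using (ℤ; +_; -[1+_])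
import Data.Integer.Properties as ℤP
open import Data.Fin using (Fin)
open import Data.Vec using ([]; _∷_; lookup; tabulate)
import Data.Vec.Properties as VecP
open import Data.List using ([]; _∷_; _++_; [_]; length; replicate)
import Data.List.Properties as ListP
open import Data.List.Relation.Unary.All as All using (All; []; _∷_)
import Data.List.Relation.Unary.All.Properties as AllP
open import Data.List.Membership.Propositional using (_∈_)
import Data.List.Extrema
open import Data.Product using (Σ; _×_; _,_; proj₁)
open import Data.Sum using (inj₁; inj₂)
open import Function using (id; flip)
open import Relation.Binary.PropositionalEquality hiding ([_])

·-suc : ∀ {k} (n : ℕ) (x : V k) → suc n · x ≡ x ⊕ (n · x)
·-suc n []      = refl
·-suc n (z ∷ x) = cong₂ _∷_ (ℤP.suc-* (+ n) z) (·-suc n x)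

module _ {k : ℕ} where

  ⊕-assoc : (x y z : V k) → (x ⊕ y) ⊕ z ≡ x ⊕ (y ⊕ z)
  ⊕-assoc = VecP.zipWith-assoc ℤP.+-assoc

  ⊕-comm : (x y : V k) → x ⊕ y ≡ y ⊕ x
  ⊕-comm = VecP.zipWith-comm ℤP.+-comm

  ⊕-identityˡ : (x : V k) → zeroV ⊕ x ≡ x
  ⊕-identityˡ = VecP.zipWith-identityˡ ℤP.+-identityˡ

  ⊕-identityʳ : (x : V k) → x ⊕ zeroV ≡ x
  ⊕-identityʳ = VecP.zipWith-identityʳ ℤP.+-identityʳ

  ℤᵏ-abelianGroup : AbelianGroup 0ℓ 0ℓ
  ℤᵏ-abelianGroup = record
    { Carrier = V k ; _≈_ = _≡_ ; _∙_ = _⊕_ ; ε = zeroV ; _⁻¹ = ⊖_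
    ; isAbelianGroup = record
      { isGroup = record
        { isMonoid = record
          { isSemigroup = record
            { isMagma = record { isEquivalence = isEquivalence ; ∙-cong = cong₂ _⊕_ }
            ; assoc = ⊕-assoc }
          ; identity = ⊕-identityˡ , ⊕-identityʳ }
        ; inverse = VecP.zipWith-inverseˡ ℤP.+-inverseˡ , VecP.zipWith-inverseʳ ℤP.+-inverseʳ
        ; ⁻¹-cong = cong ⊖_ }
      ; comm = ⊕-comm } }

  private
    module Gᵏ = AbelianGroupProperties ℤᵏ-abelianGroup

  ⊕-cancelˡ : ∀ x {y z : V k} → x ⊕ y ≡ x ⊕ z → y ≡ z
  ⊕-cancelˡ x = Gᵏ.∙-cancelˡ x _ _

  ⊕-⊝-cancel : (x y : V k) → x ⊕ (y ⊝ x) ≡ y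
  ⊕-⊝-cancel x y = trans (⊕-comm x (y ⊝ x)) (Gᵏ.//-rightDividesˡ x y)

  ⊝-⊕-cancel : (x a : V k) → (x ⊕ a) ⊝ x ≡ a
  ⊝-⊕-cancel = Gᵏ.xyx⁻¹≈y

  lookup-ext : {x y : V k} → (∀ i → lookup x i ≡ lookup y i) → x ≡ y
  lookup-ext {x} {y} eq = begin
    x                   ≡⟨ VecP.tabulate∘lookup x ⟨
    tabulate (lookup x) ≡⟨ VecP.tabulate-cong eq ⟩
    tabulate (lookup y) ≡⟨ VecP.tabulate∘lookup y ⟩
    y                   ∎
    where open ≡-Reasoning

  wsum-++ : (p q : List (V k)) → wsum (p ++ q) ≡ wsum p ⊕ wsum q
  wsum-++ []      q = sym (⊕-identityˡ (wsum q))
  wsum-++ (a ∷ p) q = trans (cong (a ⊕_) (wsum-++ p q)) (sym (⊕-assoc a (wsum p) (wsum q)))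

  wsum-replicate : (n : ℕ) (a : V k) → wsum (replicate n a) ≡ n · a
  wsum-replicate zero    a = sym (VecP.map-const a (+ 0))
  wsum-replicate (suc n) a = trans (cong (a ⊕_) (wsum-replicate n a)) (sym (·-suc n a))

rotation-invariant : {A : Set} (b : A) (t : List A) → t ++ [ b ] ≡ b ∷ t → t ≡ replicate (length t) b
rotation-invariant b []      _  = refl
rotation-invariant b (c ∷ t) eq with ListP.∷-injectiveˡ eq
... | refl = cong (b ∷_) (rotation-invariant b t (ListP.∷-injectiveʳ eq))

-- Parallel walks: Track R u v p q says that the walks u, u+p₁, u+p₁+p₂, …
-- and v, v+q₁, v+q₁+q₂, … have the same length and are related by R step by step.
data Track {k : ℕ} (R : V k → V k → Set) : V k → V k → List (V k) → List (V k) → Set where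
  stop : ∀ {u v} → R u v → Track R u v [] []
  step : ∀ {u v a b p q} → R u v → Track R (u ⊕ a) (v ⊕ b) p q → Track R u v (a ∷ p) (b ∷ q)

Functional : {k : ℕ} → (V k → V k → Set) → Set
Functional R = ∀ {x y y'} → R x y → R x y' → y ≡ y'

module _ {k : ℕ} {R : V k → V k → Set} where

  track-head : ∀ {u v p q} → Track R u v p q → R u v
  track-head (stop ruv)   = ruv
  track-head (step ruv _) = ruv

  track-last : ∀ {u v p q} → Track R u v p q → R (u ⊕ wsum p) (v ⊕ wsum q)
  track-last {u} {v} (stop ruv) = subst₂ R (sym (⊕-identityʳ u)) (sym (⊕-identityʳ v)) ruv
  track-last {u} {v} (step {a = a} {b} {p} {q} _ t) =
    subst₂ R (⊕-assoc u a (wsum p)) (⊕-assoc v b (wsum q)) (track-last t)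

  track-length : ∀ {u v p q} → Track R u v p q → length p ≡ length q
  track-length (stop _)   = refl
  track-length (step _ t) = cong suc (track-length t)

  track-flip : ∀ {u v p q} → Track R u v p q → Track (flip R) v u q p
  track-flip (stop ruv)   = stop ruv
  track-flip (step ruv t) = step ruv (track-flip t)

  track-unique : Functional R → ∀ {u v p q q'} → Track R u v p q → Track R u v p q' → q ≡ q'
  track-unique F (stop _) (stop _) = refl
  track-unique F {v = v} (step _ t) (step _ t') with ⊕-cancelˡ v (F (track-head t) (track-head t'))
  ... | refl = cong (_ ∷_) (track-unique F t t')

-≤⇒nonneg : ∀ i → ℤ.- i ℤ.≤ i → + 0 ℤ.≤ i
-≤⇒nonneg (+ n)    _  = ℤ.+≤+ z≤n
-≤⇒nonneg -[1+ n ] ()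

≤+⇒nonneg : ∀ i j → i ℤ.≤ j ℤ.+ i → + 0 ℤ.≤ j
≤+⇒nonneg i j le = subst (+ 0 ℤ.≤_) (ℤG.//-rightDividesʳ i j) (ℤP.i≤j⇒0≤j-i le)
  where module ℤG = AbelianGroupProperties ℤP.+-0-abelianGroup

record Additive {k : ℕ} (f : V k → ℤ) : Set where
  field
    hom-⊕ : ∀ x y → f (x ⊕ y) ≡ f x ℤ.+ f y
    hom-⊖ : ∀ x → f (⊖ x) ≡ ℤ.- f x

coordinate-additive : ∀ {k} (i : Fin k) → Additive (λ x → lookup x i)
coordinate-additive i = record
  { hom-⊕ = VecP.lookup-zipWith ℤ._+_ i
  ; hom-⊖ = VecP.lookup-map i (λ z → ℤ.- z) }

neg-additive : ∀ {k} {f : V k → ℤ} → Additive f → Additive (λ x → ℤ.- f x)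
neg-additive {f = f} hom = record
  { hom-⊕ = λ x y → trans (cong (λ z → ℤ.- z) (hom-⊕ x y)) (ℤP.neg-distrib-+ (f x) (f y))
  ; hom-⊖ = λ x → cong (λ z → ℤ.- z) (hom-⊖ x) }
  where open Additive hom

module CayleyBalls {k : ℕ} (𝒜 : List (V k)) where
  open Cayley 𝒜

  ball-zero : ∀ {s} → DistLe s zeroV
  ball-zero = [] , [] , z≤n , refl

  ball-mono : ∀ {s t x} → s ≤ t → DistLe s x → DistLe t x
  ball-mono s≤t (p , wp , lp , sp) = p , wp , ℕP.≤-trans lp s≤t , sp

  ball-step : ∀ {s u a} → a ∈ 𝒜 → DistLe s u → DistLe (suc s) (u ⊕ a)
  ball-step {a = a} a∈ (p , wp , lp , sp) =
    a ∷ p , a∈ ∷ wp , s≤s lp , trans (cong (a ⊕_) sp) (⊕-comm a _)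

  adj-step : ∀ {u a} → a ∈ 𝒜 → Adj u (u ⊕ a)
  adj-step {u} {a} a∈ = subst (_∈ 𝒜) (sym (⊝-⊕-cancel u a)) a∈

  secondary⇒ball : ∀ {s x} → W'.DistLe s x → DistLe s x
  secondary⇒ball (p , sp , lp , e) = p , All.map proj₁ sp , lp , e

  record BallMap (r : ℕ) (R : V k → V k → Set) : Set where
    field
      total         : ∀ x → DistLe r x → Σ (V k) λ y → DistLe r y × R x y
      functional    : Functional R
      preserves-adj : ∀ {x y x' y'} → R x y → R x' y' → Adj x x' → Adj y y'

  record BallIso (r : ℕ) (R : V k → V k → Set) : Set where
    field
      forth : BallMap r R
      back  : BallMap r (flip R)

  ball-iso-sym : ∀ {r R} → BallIso r R → BallIso r (flip R)
  ball-iso-sym iso = record { forth = BallIso.back iso ; back = BallIso.forth iso }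

  lift-edge : ∀ {r R} → BallMap r R → ∀ {s u v a} → R u v → DistLe s u → suc s ≤ r → a ∈ 𝒜 →
              Σ (V k) λ b → b ∈ 𝒜 × R (u ⊕ a) (v ⊕ b)
  lift-edge {R = R} M {u = u} {v} {a} ruv du s<r a∈
    with BallMap.total M (u ⊕ a) (ball-mono s<r (ball-step a∈ du))
  ... | v′ , _ , ruv′ =
    v′ ⊝ v , BallMap.preserves-adj M ruv ruv′ (adj-step a∈) ,
    subst (R (u ⊕ a)) (sym (⊕-⊝-cancel v v′)) ruv′

  lift-walk : ∀ {r R} → BallMap r R → ∀ {s u v p} → R u v → DistLe s u → s + length p ≤ r →
              Word p → Σ (List (V k)) λ q → Word q × Track R u v p q
  lift-walk M {p = []} ruv _ _ [] = [] , [] , stop ruv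
  lift-walk {r} M {s} {p = a ∷ p} ruv du bound (a∈ ∷ wp)
    with lift-edge M ruv du (ℕP.≤-trans (ℕP.m<m+n s (s≤s z≤n)) bound) a∈
  ... | b , b∈ , ruvb
    with lift-walk M ruvb (ball-step a∈ du) (subst (_≤ r) (ℕP.+-suc s (length p)) bound) wp
  ... | q , wq , t = b ∷ q , b∈ ∷ wq , step ruv t

  lift-point : ∀ {r R} → BallMap r R → ∀ {y p} → R zeroV y → length p ≤ r → Word p →
               Σ (List (V k)) λ q → Word q × length q ≡ length p × R (wsum p) (y ⊕ wsum q)
  lift-point {R = R} M {y} {p} r0y lp wp with lift-walk M r0y ball-zero lp wp
  ... | q , wq , t =
    q , wq , sym (track-length t) ,
    subst (λ x → R x (y ⊕ wsum q)) (⊕-identityˡ (wsum p)) (track-last t)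

  CoversBall : ℕ → V k → Set
  CoversBall r v = ∀ w → DistLe r w → Σ (List (V k)) λ q → Word q × length q ≤ r × v ⊕ wsum q ≡ w

  -- Extremal argument for an additive f and a maximiser a of f on 𝒜 with
  -- f a ≥ 0: words of length ≤ n have f-value ≤ f(n·a), so if v covers B_r
  -- then f v + f q = f(r·a) ≥ f q for the word q with v + q = r·a, i.e. f v ≥ 0.
  module Extremal {r v} (cover : CoversBall r v) {f : V k → ℤ} (hom : Additive f)
                  {a} (a∈ : a ∈ 𝒜) (maximal : ∀ {b} → b ∈ 𝒜 → f b ℤ.≤ f a)
                  (0≤fa : + 0 ℤ.≤ f a) where
    open Additive hom

    power : ℕ → V k
    power n = wsum (replicate n a)

    g : ℕ → ℤ
    g n = f (power n)

    g-mono : ∀ {m n} → m ≤′ n → g m ℤ.≤ g n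
    g-mono ≤′-refl = ℤP.≤-refl
    g-mono {m} (≤′-step {n} m≤n) = begin
      g m              ≤⟨ g-mono m≤n ⟩
      g n              ≡⟨ ℤP.+-identityˡ (g n) ⟨
      + 0 ℤ.+ g n      ≤⟨ ℤP.+-monoˡ-≤ (g n) 0≤fa ⟩
      f a ℤ.+ g n      ≡⟨ hom-⊕ a (power n) ⟨
      g (suc n)        ∎
      where open ℤP.≤-Reasoning

    word-bound : ∀ {q} → Word q → f (wsum q) ℤ.≤ g (length q)
    word-bound []        = ℤP.≤-refl
    word-bound (b∈ ∷ wq) = subst₂ ℤ._≤_ (sym (hom-⊕ _ _)) (sym (hom-⊕ a _))
      (ℤP.+-mono-≤ (maximal b∈) (word-bound wq))

    nonneg : + 0 ℤ.≤ f v
    nonneg with cover (power r) (replicate r a , AllP.replicate⁺ r a∈ , ℕP.≤-reflexive (ListP.length-replicate r) , refl)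
    ... | q , wq , lq , e = ≤+⇒nonneg (f (wsum q)) (f v) (begin
      f (wsum q)          ≤⟨ word-bound wq ⟩
      g (length q)        ≤⟨ g-mono (ℕP.≤⇒≤′ lq) ⟩
      g r                 ≡⟨ cong f e ⟨
      f (v ⊕ wsum q)      ≡⟨ hom-⊕ v (wsum q) ⟩
      f v ℤ.+ f (wsum q)  ∎)
      where open ℤP.≤-Reasoning

  UniqueGeodesic : List (V k) → Set
  UniqueGeodesic p = ∀ w → Word w → length w ≤ length p → wsum w ≡ wsum p → w ≡ p

  power-geodesic : ∀ {n a} → a ∈ 𝒜 → DistEqUnique (n · a) n → UniqueGeodesic (replicate n a)
  power-geodesic {n} {a} a∈ ((_ , minimal) , unique) w ww lw sw =
    unique w (replicate n a) ww (AllP.replicate⁺ n a∈) |w|≡n (ListP.length-replicate n) sw′ (wsum-replicate n a)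
    where
      sw′ : wsum w ≡ n · a
      sw′ = trans sw (wsum-replicate n a)
      |w|≡n : length w ≡ n
      |w|≡n = ℕP.≤-antisym (subst (length w ≤_) (ListP.length-replicate n) lw) (minimal w ww sw′)

  geodesic⇒DistEqUnique : ∀ {p} → Word p → UniqueGeodesic p → DistEqUnique (wsum p) (length p)
  geodesic⇒DistEqUnique {p} wp geo = ((p , wp , refl , refl) , minimal) , unique
    where
      minimal : ∀ w → Word w → wsum w ≡ wsum p → length p ≤ length w
      minimal w ww sw with ℕP.≤-total (length p) (length w)
      ... | inj₁ p≤w = p≤w
      ... | inj₂ w≤p = ℕP.≤-reflexive (cong length (sym (geo w ww w≤p sw)))
      unique : AtMostOneGeodesic (wsum p) (length p)
      unique w₁ w₂ ww₁ ww₂ l₁ l₂ s₁ s₂ =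
        trans (geo w₁ ww₁ (ℕP.≤-reflexive l₁) s₁) (sym (geo w₂ ww₂ (ℕP.≤-reflexive l₂) s₂))

  -- A unique geodesic b·c equals its rotation c·b (same length and value), so it is bⁿ.
  geodesic-constant : ∀ {b c} → Word (b ∷ c) → UniqueGeodesic (b ∷ c) → c ≡ replicate (length c) b
  geodesic-constant {b} {c} (b∈ ∷ wc) geo = rotation-invariant b c
    (geo (c ++ [ b ]) (AllP.++⁺ wc (b∈ ∷ [])) (ℕP.≤-reflexive (ListP.length-++-comm c [ b ])) value)
    where
      value : wsum (c ++ [ b ]) ≡ b ⊕ wsum c
      value = trans (wsum-++ c [ b ]) (trans (cong (wsum c ⊕_) (⊕-identityʳ b)) (⊕-comm (wsum c) b))

  module Symmetric (symm : ∀ a → a ∈ 𝒜 → (⊖ a) ∈ 𝒜) where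

    -- Any vertex covering B_r is ≥ 0 under every additive f; the maximiser
    -- a of f on 𝒜 has f a ≥ f(⊖a) = −f a by symmetry of 𝒜.
    covers⇒nonneg : ∀ {r v a₀} → a₀ ∈ 𝒜 → CoversBall r v → ∀ f → Additive f → + 0 ℤ.≤ f v
    covers⇒nonneg {a₀ = a₀} a₀∈ cover f hom = Extremal.nonneg cover hom a∈ maximal 0≤fa
      where
        module Ex = Data.List.Extrema ℤP.≤-totalOrder
        a : V k
        a = Ex.argmax f a₀ 𝒜
        a∈ : a ∈ 𝒜
        a∈ = Ex.argmax-all f a₀∈ (All.tabulate id)
        maximal : ∀ {b} → b ∈ 𝒜 → f b ℤ.≤ f a
        maximal = All.lookup (Ex.f[xs]≤f[argmax] a₀ 𝒜)
        0≤fa : + 0 ℤ.≤ f a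
        0≤fa = -≤⇒nonneg (f a) (subst (ℤ._≤ f a) (Additive.hom-⊖ hom a) (maximal (symm a a∈)))

    -- The centre is the only vertex covering B_r: if the word reaching 0 from v
    -- is empty then v = 0; otherwise its first letter lies in 𝒜 and
    -- covers⇒nonneg applies to every coordinate and to its negative.
    covers⇒zero : ∀ {r v} → CoversBall r v → v ≡ zeroV
    covers⇒zero {v = v} cover with cover zeroV ball-zero
    ... | [] , _ , _ , e = trans (sym (⊕-identityʳ v)) e
    ... | _ ∷ _ , a₀∈ ∷ _ , _ , _ = lookup-ext λ i → trans
      (ℤP.≤-antisym (ℤP.neg-cancel-≤ {+ 0} {lookup v i} (nonneg (neg-additive (coordinate-additive i))))
                    (nonneg (coordinate-additive i)))
      (sym (VecP.lookup-replicate i (+ 0)))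
      where
        nonneg : ∀ {f} → Additive f → + 0 ℤ.≤ f v
        nonneg = covers⇒nonneg a₀∈ cover _

    module _ {r R} (iso : BallIso r R) where
      open BallIso iso
      private
        module F = BallMap forth
        module B = BallMap back

      -- All of B_r is reached from an image y of 0: lift the word of a
      -- preimage x of w to a word from y, which must end at the image w of x.
      image-of-zero-covers : ∀ {y} → R zeroV y → CoversBall r y
      image-of-zero-covers {y} r0y w bw with B.total w bw
      ... | x , (p , wp , lp , sp) , rxw with lift-point forth r0y lp wp
      ... | q , wq , lq , rpq =
        q , wq , subst (_≤ r) (sym lq) lp , F.functional (subst (λ z → R z (y ⊕ wsum q)) sp rpq) rxw

      fixes-zero : R zeroV zeroV
      fixes-zero with F.total zeroV ball-zero
      ... | y , _ , r0y = subst (R zeroV) (covers⇒zero (image-of-zero-covers r0y)) r0y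

      -- Since 0 is fixed, lifting a word of length ≤ s from 0 shows that R maps B_s into B_s.
      preserves-radius : ∀ {s u v} → s ≤ r → R u v → DistLe s u → DistLe s v
      preserves-radius {s} s≤r ruv (p , wp , lp , sp) with lift-point forth fixes-zero (ℕP.≤-trans lp s≤r) wp
      ... | q , wq , lq , rpq =
        q , wq , subst (_≤ s) (sym lq) lp ,
        trans (sym (⊕-identityˡ (wsum q))) (F.functional (subst (λ z → R z _) sp rpq) ruv)

      pull-back : ∀ {s u v p q w} → Track R u v p q → DistLe s u → s + length p ≤ r →
                  Word w → length w ≤ length q →
                  Σ (List (V k)) λ e → Word e × length e ≤ length p × Track R u v e w
      pull-back {s} {p = p} {w = w} t du bound ww lw =
        let e , we , t′ = lift-walk back (track-head t) (preserves-radius s≤r (track-head t) du)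
                                    (ℕP.≤-trans (ℕP.+-monoʳ-≤ s w≤p) bound) ww
        in e , we , ℕP.≤-trans (ℕP.≤-reflexive (sym (track-length t′))) w≤p , track-flip t′
        where
          s≤r : s ≤ r
          s≤r = ℕP.≤-trans (ℕP.m≤m+n s (length p)) bound
          w≤p : length w ≤ length p
          w≤p = subst (_ ≤_) (sym (track-length t)) lw

      -- Unique geodesics transfer along lifted walks: a competitor w of q
      -- pulls back to a competitor e of p with the same value (R⁻¹ is
      -- functional), so e = p, and then w = q since both are determined by p.
      track-geodesic : ∀ {s u v p q} → Track R u v p q → DistLe s u → s + length p ≤ r →
                       UniqueGeodesic p → UniqueGeodesic q
      track-geodesic {u = u} {v} {p} t du bound geo w ww lw sw with pull-back t du bound ww lw
      ... | e , we , e≤p , t′ = track-unique F.functional (subst (λ z → Track R u v z w) e≡p t′) t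
        where
          e-value : wsum e ≡ wsum p
          e-value = ⊕-cancelˡ u (B.functional (subst (R _) (cong (v ⊕_) sw) (track-last t′)) (track-last t))
          e≡p : e ≡ p
          e≡p = geo e we e≤p e-value

      -- Lifting a unique geodesic a·p from u along an edge u → u+a whose image
      -- is v → v+b gives a unique geodesic b·c from v (its first letter is b
      -- because R is functional).
      lift-geodesic : ∀ {s u v a b p} → R u v → R (u ⊕ a) (v ⊕ b) → DistLe s u → s + length (a ∷ p) ≤ r →
                      Word (a ∷ p) → UniqueGeodesic (a ∷ p) →
                      Σ (List (V k)) λ c → Word (b ∷ c) × length c ≡ length p × UniqueGeodesic (b ∷ c)
      lift-geodesic {v = v} ruv ruvab du bound wp geo with lift-walk forth ruv du bound wp
      ... | b′ ∷ c , wq , t@(step _ t₁) with ⊕-cancelˡ v (F.functional (track-head t₁) ruvab)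
      ... | refl = c , wq , ℕP.suc-injective (sym (track-length t)) , track-geodesic t du bound geo

      -- The key step: if the edge u → u+a has image v → v+b, with u deep
      -- enough in the ball, and aⁿ is a unique geodesic, then so is bⁿ: the
      -- lift of aⁿ is a unique geodesic starting with b, hence constant.
      power-transfer : ∀ {n s u v a b} → 1 ≤ n → R u v → R (u ⊕ a) (v ⊕ b) → DistLe s u → s + n ≤ r →
                       a ∈ 𝒜 → DistEqUnique (n · a) n → DistEqUnique (n · b) n
      power-transfer {suc m} {s} {a = a} {b} _ ruv ruvab du bound a∈ power-a
        with lift-geodesic ruv ruvab du
               (subst (λ n → s + suc n ≤ r) (sym (ListP.length-replicate m)) bound)
               (AllP.replicate⁺ (suc m) a∈) (power-geodesic a∈ power-a)
      ... | c , wbc , lc , geo = subst₂ DistEqUnique value len (geodesic⇒DistEqUnique wbc geo)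
        where
          len : length (b ∷ c) ≡ suc m
          len = cong suc (trans lc (ListP.length-replicate m))
          value : wsum (b ∷ c) ≡ suc m · b
          value = trans (cong (λ z → wsum (b ∷ z)) (geodesic-constant wbc geo))
                        (trans (wsum-replicate (suc (length c)) b) (cong (_· b) len))

  module Secondaries (symm : ∀ a → a ∈ 𝒜 → (⊖ a) ∈ 𝒜)
                     (D : ℕ) (1≤D : 1 ≤ D)
                     (D-property : ∀ x → Secondary x → ¬ DistEqUnique (D · x) D)
                     {r r′ : ℕ} (r′+D≤r : r′ + D ≤ r) where
    open Symmetric symm

    r′≤r : r′ ≤ r
    r′≤r = ℕP.≤-trans (ℕP.m≤m+n r′ D) r′+D≤r

    module _ {R} (iso : BallIso r R) where

      -- If b were primary, D·b would have a unique geodesic of length D, and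
      -- power-transfer along the converse would give the same for a.
      secondary-step : ∀ {u v a b} → R u v → R (u ⊕ a) (v ⊕ b) → DistLe r′ u → b ∈ 𝒜 →
                       Secondary a → Secondary b
      secondary-step ruv ruvab du b∈ sa = b∈ , λ b-primary → D-property _ sa
        (power-transfer (ball-iso-sym iso) 1≤D ruv ruvab (preserves-radius iso r′≤r ruv du) r′+D≤r
           b∈ (b-primary D))

      track-secondary : ∀ {s u v p q} → Track R u v p q → Word q → DistLe s u → s + length p ≤ r′ →
                        All Secondary p → All Secondary q
      track-secondary (stop _) [] _ _ [] = []
      track-secondary {s} (step ruv t) (b∈ ∷ wq) du bound (sa ∷ sp) =
        secondary-step ruv (track-head t) (ball-mono (ℕP.≤-trans (ℕP.m≤m+n s _) bound) du) b∈ sa ∷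
        track-secondary t wq (ball-step (proj₁ sa) du) (subst (_≤ r′) (ℕP.+-suc s _) bound) sp

      secondary-image : ∀ x → W'.DistLe r′ x → Σ (V k) λ y → W'.DistLe r′ y × R x y
      secondary-image _ (p , sp , lp , refl)
        with lift-walk (BallIso.forth iso) (fixes-zero iso) ball-zero (ℕP.≤-trans lp r′≤r) (All.map proj₁ sp)
      ... | q , wq , t =
        wsum q , (q , track-secondary t wq ball-zero lp sp , subst (_≤ r′) (track-length t) lp , refl) ,
        subst₂ R (⊕-identityˡ (wsum p)) (⊕-identityˡ (wsum q)) (track-last t)

      secondary-adj : ∀ {x y x′ y′} → R x y → R x′ y′ → DistLe r′ x → W'.Adj x x′ → W'.Adj y y′
      secondary-adj {x} {y} {x′} {y′} rxy rx′y′ dx sa =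
        secondary-step rxy (subst₂ R (sym (⊕-⊝-cancel x x′)) (sym (⊕-⊝-cancel y y′)) rx′y′) dx
          (BallMap.preserves-adj (BallIso.forth iso) rxy rx′y′ (proj₁ sa)) sa

automorphism-graph : ∀ {k} {𝒜 : List (V k)} {r φ} → Cayley.IsAutB 𝒜 r φ →
                     CayleyBalls.BallIso 𝒜 r (λ x y → Cayley.DistLe 𝒜 r x × φ x ≡ y)
automorphism-graph {φ = φ} aut = record
  { forth = record
    { total         = λ x bx → φ x , maps-to x bx , bx , refl
    ; functional    = λ { (_ , refl) (_ , refl) → refl }
    ; preserves-adj = λ { (bx , refl) (bx′ , refl) → adj→ _ _ bx bx′ } }
  ; back = record
    { total         = λ y by → let x , bx , φx≡y = surjective y by in x , bx , bx , φx≡y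
    ; functional    = λ { (bx , e) (bx′ , e′) → injective _ _ bx bx′ (trans e (sym e′)) }
    ; preserves-adj = λ { (bx , refl) (bx′ , refl) → adj← _ _ bx bx′ } } }
  where open IsGraphAut aut

lemma4 : (k : ℕ) → 1 ≤ k → (𝒜 : List (V k)) → Cayley.Hyp 𝒜 →
    (D : ℕ) → 1 ≤ D →
    (∀ x → Cayley.Secondary 𝒜 x → ¬ Cayley.DistEqUnique 𝒜 (D · x) D) →
    (r : ℕ) → (2 ⊔ (D ⊔ (2 * Cayley.normA 𝒜 + 1))) ≤ r →
    (φ : V k → V k) → Cayley.IsAutB 𝒜 r φ →
    Cayley.IsAutB' 𝒜 (r ∸ (2 ⊔ (D ⊔ (2 * Cayley.normA 𝒜 + 1)))) φ
lemma4 k _ 𝒜 hyp D 1≤D D-property r r₀≤r φ aut = record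
  { maps-to    = λ x bx → let _ , by , (_ , φx≡y) = secondary-image iso x bx
                          in subst (W'.DistLe r′) (sym φx≡y) by
  ; injective  = λ x y bx by → IsGraphAut.injective aut x y (in-ball bx) (in-ball by)
  ; surjective = λ y by → let x , bx , (_ , φx≡y) = secondary-image (ball-iso-sym iso) y by
                          in x , bx , φx≡y
  ; adj→       = λ x y bx by → secondary-adj iso (in-ball bx , refl) (in-ball by , refl) (secondary⇒ball bx)
  ; adj←       = λ x y bx by → secondary-adj (ball-iso-sym iso) (in-ball bx , refl) (in-ball by , refl)
                                 (preserves-radius iso r′≤r (in-ball bx , refl) (secondary⇒ball bx)) }
  where
    open Cayley 𝒜
    open CayleyBalls 𝒜
    r₀ r′ : ℕ
    r₀ = 2 ⊔ (D ⊔ (2 * normA + 1))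
    r′ = r ∸ r₀
    -- D ≤ r₀, so r′ + D ≤ r′ + r₀ = r.
    r′+D≤r : r′ + D ≤ r
    r′+D≤r = ℕP.≤-trans (ℕP.+-monoʳ-≤ r′ (ℕP.≤-trans (ℕP.m≤m⊔n D _) (ℕP.m≤n⊔m 2 _)))
                        (ℕP.≤-reflexive (ℕP.m∸n+n≡m r₀≤r))
    open Symmetric (Hyp.symm hyp)
    open Secondaries (Hyp.symm hyp) D 1≤D D-property r′+D≤r
    iso : BallIso r (λ x y → DistLe r x × φ x ≡ y)
    iso = automorphism-graph aut
    in-ball : ∀ {x} → W'.DistLe r′ x → DistLe r x
    in-ball bx = ball-mono r′≤r (secondary⇒ball bx)
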